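{- Let $n\ge 4$ and let $\mathbf{b}_1=\overline{10}[n]$, $\mathbf{b}_2=01\cdot\overline{0}[n-2]$, $\mathbf{b}_3=\overline{0}[n-2]\cdot 11$, $\mathbf{b}_4=\overline{01}[n]$, $\mathbf{b}_5=11\cdot\overline{0}[n-2]$, $\mathbf{b}_6=\overline{0}[n-2]\cdot 10$. (i) If $n$ is even, then $|T(\mathbf{b}_i)|=(3n-2)/2$ for all $i\in\{1,\ldots,6\}$. (ii) If $n$ is odd, then $|T(\mathbf{b}_1)|=|T(\mathbf{b}_3)|=|T(\mathbf{b}_5)|=(3n-1)/2$ and $|T(\mathbf{b}_2)|=|T(\mathbf{b}_4)|=|T(\mathbf{b}_6)|=(3n-3)/2$.
   Context: For $\mathbf{x}=(x_0,\ldots,x_{n-1})\in\mathbb{F}_2^n$, the derivative is $\partial\mathbf{x}=(x_0+x_1,\ldots,x_{n-2}+x_{n-1})\in\mathbb{F}_2^{n-1}$, with $\partial^0\mathbf{x}=\mathbf{x}$ and $\partial^i\mathbf{x}=\partial(\partial^{i-1}\mathbf{x})$. The Steinhaus triangle is $T(\mathbf{x})=(\mathbf{x},\partial\mathbf{x},\ldots,\partial^{n-1}\mathbf{x})$; $|\mathbf{y}|$ is the number of ones of a binary sequence and $|T(\mathbf{x})|=\sum_{i=0}^{n-1}|\partial^i\mathbf{x}|$. Sequences are written as words; a dot denotes concatenation; $\overline{x_1\cdots x_p}[k]$ is the word of the first $k$ letters of the infinite periodic word $x_1\cdots x_px_1\cdots x_p\cdots$. -}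

module Defs where

open import Data.Bool using (Bool; true; false; _xor_)
open import Data.List using (List; []; _∷_; _++_; length; replicate)
open import Data.Nat using (ℕ; zero; suc; _+_)

-- Binary sequences over F₂ are lists of Bool (true = 1), addition in F₂ is xor.

∂ : List Bool → List Bool
∂ []             = []
∂ (x ∷ [])       = []
∂ (x ∷ y ∷ xs)   = (x xor y) ∷ ∂ (y ∷ xs)

∂^ : ℕ → List Bool → List Bool
∂^ zero    x = x
∂^ (suc i) x = ∂ (∂^ i x)

weight : List Bool → ℕ
weight []          = 0
weight (true ∷ xs)  = suc (weight xs)
weight (false ∷ xs) = weight xs

sumDerivWeights : ℕ → List Bool → ℕ
sumDerivWeights zero    x = 0
sumDerivWeights (suc k) x = sumDerivWeights k x + weight (∂^ k x)

-- |T(x)| = Σ_{i=0}^{n-1} |∂^i x| with n = length x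
weightT : List Bool → ℕ
weightT x = sumDerivWeights (length x) x

-- periodic prefix \overline{a·as}[k]: first k letters of the infinite word
-- (a ∷ as)(a ∷ as)… ; the period is nonempty by construction.
periodic : Bool → List Bool → ℕ → List Bool
periodic a as k = go (a ∷ as) k
  where
  go : List Bool → ℕ → List Bool
  go _        zero    = []
  go []       (suc k) = a ∷ go as k
  go (b ∷ bs) (suc k) = b ∷ go bs k

-- A word of period 2 has derivative 1ⁿ⁻¹, whose own triangle contributes only its first row;
-- a two-letter word padded with zeros (on either side) is sent by ∂² to the same word with two
-- zeros fewer. In both cases |T| grows by exactly 3 when n grows by 2, so 2|T(bᵢ)| - 3n only
-- depends on the parity of n, and is read off from n = 2 and n = 3.
module Submission where

open import Defs
open import Data.Bool using (Bool; true; false; not; _xor_)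
open import Data.Bool.Properties using (xor-same; xor-assoc; xor-identityʳ; xor-inverseʳ; not-involutive)
open import Data.List using (List; []; _∷_; _++_; length; replicate)
open import Data.Nat using (ℕ; zero; suc; _+_; _*_; _∸_; _≤_; s≤s)
open import Data.Nat.Divisibility using (_∣_; _∣0; n∣m*n; ∣m∣n⇒∣m+n; ∣m+n∣m⇒∣n; ∣1⇒≡1)
open import Data.Nat.Properties using (+-assoc; +-suc; +-identityʳ; *-distribˡ-+; m+n∸n≡m)
open import Data.Product using (_×_; _,_)
open import Relation.Nullary using (¬_; contradiction)
open import Relation.Binary.PropositionalEquality
  using (_≡_; refl; sym; trans; cong; cong₂; module ≡-Reasoning)
open ≡-Reasoning

∂^-suc : ∀ k x → ∂^ (suc k) x ≡ ∂^ k (∂ x)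
∂^-suc zero    x = refl
∂^-suc (suc k) x = cong ∂ (∂^-suc k x)

sumDerivWeights-suc : ∀ k x → sumDerivWeights (suc k) x ≡ weight x + sumDerivWeights k (∂ x)
sumDerivWeights-suc zero    x = sym (+-identityʳ (weight x))
sumDerivWeights-suc (suc k) x = begin
  sumDerivWeights (suc k) x + weight (∂^ (suc k) x)
    ≡⟨ cong₂ _+_ (sumDerivWeights-suc k x) (cong weight (∂^-suc k x)) ⟩
  weight x + sumDerivWeights k (∂ x) + weight (∂^ k (∂ x))
    ≡⟨ +-assoc (weight x) _ _ ⟩
  weight x + sumDerivWeights (suc k) (∂ x) ∎

length-∂ : ∀ b xs → length (∂ (b ∷ xs)) ≡ length xs
length-∂ b []       = refl
length-∂ b (c ∷ xs) = cong suc (length-∂ c xs)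

weightT-∂ : ∀ x → weightT x ≡ weight x + weightT (∂ x)
weightT-∂ []       = refl
weightT-∂ (b ∷ xs) = trans (sumDerivWeights-suc (length xs) (b ∷ xs))
  (cong (λ k → weight (b ∷ xs) + sumDerivWeights k (∂ (b ∷ xs))) (sym (length-∂ b xs)))

weightT-∂² : ∀ x → weightT x ≡ weight x + weight (∂ x) + weightT (∂ (∂ x))
weightT-∂² x = trans (weightT-∂ x)
  (trans (cong (weight x +_) (weightT-∂ (∂ x))) (sym (+-assoc (weight x) _ _)))

weight-++ : ∀ xs ys → weight (xs ++ ys) ≡ weight xs + weight ys
weight-++ []           ys = refl
weight-++ (true ∷ xs)  ys = cong suc (weight-++ xs ys)
weight-++ (false ∷ xs) ys = weight-++ xs ys

weight-replicate-false : ∀ m → weight (replicate m false) ≡ 0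
weight-replicate-false zero    = refl
weight-replicate-false (suc m) = weight-replicate-false m

weight-replicate-true : ∀ m → weight (replicate m true) ≡ m
weight-replicate-true zero    = refl
weight-replicate-true (suc m) = cong suc (weight-replicate-true m)

weight-++-replicate-false : ∀ xs m → weight (xs ++ replicate m false) ≡ weight xs
weight-++-replicate-false xs m =
  trans (weight-++ xs _) (trans (cong (weight xs +_) (weight-replicate-false m)) (+-identityʳ _))

weight-replicate-false-++ : ∀ m xs → weight (replicate m false ++ xs) ≡ weight xs
weight-replicate-false-++ m xs =
  trans (weight-++ (replicate m false) xs) (cong (_+ weight xs) (weight-replicate-false m))

∂-replicate : ∀ b m → ∂ (replicate (suc m) b) ≡ replicate m false
∂-replicate b zero    = refl
∂-replicate b (suc m) = cong₂ _∷_ (xor-same b) (∂-replicate b m)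

weightT-replicate-false : ∀ m → weightT (replicate m false) ≡ 0
weightT-replicate-false zero    = refl
weightT-replicate-false (suc m) = trans (weightT-∂ (replicate (suc m) false))
  (cong₂ _+_ (weight-replicate-false m)
    (trans (cong weightT (∂-replicate false m)) (weightT-replicate-false m)))

weightT-replicate-true : ∀ m → weightT (replicate m true) ≡ m
weightT-replicate-true zero    = refl
weightT-replicate-true (suc m) = begin
  weightT (replicate (suc m) true)
    ≡⟨ weightT-∂ (replicate (suc m) true) ⟩
  weight (replicate (suc m) true) + weightT (∂ (replicate (suc m) true))
    ≡⟨ cong₂ _+_ (weight-replicate-true (suc m))
         (trans (cong weightT (∂-replicate true m)) (weightT-replicate-false m)) ⟩
  suc m + 0
    ≡⟨ +-identityʳ (suc m) ⟩
  suc m ∎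

alternating : Bool → ℕ → List Bool
alternating b zero    = []
alternating b (suc k) = b ∷ alternating (not b) k

alternating-2+ : ∀ b k → alternating b (2 + k) ≡ b ∷ not b ∷ alternating b k
alternating-2+ b k = cong (λ c → b ∷ not b ∷ alternating c k) (not-involutive b)

weight-alternating-2+ : ∀ b k → weight (alternating b (2 + k)) ≡ 1 + weight (alternating b k)
weight-alternating-2+ true  k = refl
weight-alternating-2+ false k = refl

∂-alternating : ∀ b m → ∂ (alternating b (suc m)) ≡ replicate m true
∂-alternating b zero    = refl
∂-alternating b (suc m) = cong₂ _∷_ (xor-inverseʳ b) (∂-alternating (not b) m)

weightT-alternating : ∀ b m → weightT (alternating b (suc m)) ≡ weight (alternating b (suc m)) + m
weightT-alternating b m = trans (weightT-∂ (alternating b (suc m)))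
  (cong (weight (alternating b (suc m)) +_)
    (trans (cong weightT (∂-alternating b m)) (weightT-replicate-true m)))

weightT-alternating-2+ : ∀ b m →
  weightT (alternating b (2 + (2 + m))) ≡ 3 + weightT (alternating b (2 + m))
weightT-alternating-2+ b m = begin
  weightT (alternating b (4 + m))
    ≡⟨ weightT-alternating b (3 + m) ⟩
  weight (alternating b (4 + m)) + (3 + m)
    ≡⟨ cong (_+ (3 + m)) (weight-alternating-2+ b (2 + m)) ⟩
  suc (w + (3 + m))
    ≡⟨ cong suc (trans (+-suc w (2 + m)) (cong suc (+-suc w (1 + m)))) ⟩
  3 + (w + (1 + m))
    ≡⟨ cong (3 +_) (sym (weightT-alternating b (1 + m))) ⟩
  3 + weightT (alternating b (2 + m)) ∎
  where w = weight (alternating b (2 + m))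

∂-++-replicate : ∀ a b m →
  ∂ ((a ∷ b ∷ []) ++ replicate (suc m) false) ≡ ((a xor b) ∷ b ∷ []) ++ replicate m false
∂-++-replicate a b m = cong₂ (λ c zs → (a xor b) ∷ c ∷ zs) (xor-identityʳ b) (∂-replicate false m)

∂-replicate-++ : ∀ a b m →
  ∂ (replicate (suc m) false ++ (a ∷ b ∷ [])) ≡ replicate m false ++ (a ∷ (a xor b) ∷ [])
∂-replicate-++ a b zero    = refl
∂-replicate-++ a b (suc m) = cong (false ∷_) (∂-replicate-++ a b m)

∂²-++-replicate : ∀ a b m →
  ∂ (∂ ((a ∷ b ∷ []) ++ replicate (2 + m) false)) ≡ (a ∷ b ∷ []) ++ replicate m false
∂²-++-replicate a b m = begin
  ∂ (∂ ((a ∷ b ∷ []) ++ replicate (2 + m) false))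
    ≡⟨ cong ∂ (∂-++-replicate a b (suc m)) ⟩
  ∂ (((a xor b) ∷ b ∷ []) ++ replicate (suc m) false)
    ≡⟨ ∂-++-replicate (a xor b) b m ⟩
  (((a xor b) xor b) ∷ b ∷ []) ++ replicate m false
    ≡⟨ cong (λ c → c ∷ b ∷ replicate m false) xor-cancelʳ ⟩
  (a ∷ b ∷ []) ++ replicate m false ∎
  where
  xor-cancelʳ : (a xor b) xor b ≡ a
  xor-cancelʳ = trans (xor-assoc a b b) (trans (cong (a xor_) (xor-same b)) (xor-identityʳ a))

∂²-replicate-++ : ∀ a b m →
  ∂ (∂ (replicate (2 + m) false ++ (a ∷ b ∷ []))) ≡ replicate m false ++ (a ∷ b ∷ [])
∂²-replicate-++ a b m = begin
  ∂ (∂ (replicate (2 + m) false ++ (a ∷ b ∷ [])))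
    ≡⟨ cong ∂ (∂-replicate-++ a b (suc m)) ⟩
  ∂ (replicate (suc m) false ++ (a ∷ (a xor b) ∷ []))
    ≡⟨ ∂-replicate-++ a (a xor b) m ⟩
  replicate m false ++ (a ∷ (a xor (a xor b)) ∷ [])
    ≡⟨ cong (λ c → replicate m false ++ (a ∷ c ∷ [])) xor-cancelˡ ⟩
  replicate m false ++ (a ∷ b ∷ []) ∎
  where
  xor-cancelˡ : a xor (a xor b) ≡ b
  xor-cancelˡ = trans (sym (xor-assoc a a b)) (cong (_xor b) (xor-same a))

weightT-++-replicate-2+ : ∀ a b m →
  weightT ((a ∷ b ∷ []) ++ replicate (2 + m) false)
    ≡ weight (a ∷ b ∷ []) + weight ((a xor b) ∷ b ∷ []) + weightT ((a ∷ b ∷ []) ++ replicate m false)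
weightT-++-replicate-2+ a b m = trans (weightT-∂² x)
  (cong₂ _+_
    (cong₂ _+_ (weight-++-replicate-false (a ∷ b ∷ []) (2 + m))
      (trans (cong weight (∂-++-replicate a b (suc m)))
        (weight-++-replicate-false ((a xor b) ∷ b ∷ []) (suc m))))
    (cong weightT (∂²-++-replicate a b m)))
  where x = (a ∷ b ∷ []) ++ replicate (2 + m) false

weightT-replicate-++-2+ : ∀ a b m →
  weightT (replicate (2 + m) false ++ (a ∷ b ∷ []))
    ≡ weight (a ∷ b ∷ []) + weight (a ∷ (a xor b) ∷ []) + weightT (replicate m false ++ (a ∷ b ∷ []))
weightT-replicate-++-2+ a b m = trans (weightT-∂² x)
  (cong₂ _+_
    (cong₂ _+_ (weight-replicate-false-++ (2 + m) (a ∷ b ∷ []))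
      (trans (cong weight (∂-replicate-++ a b (suc m)))
        (weight-replicate-false-++ (suc m) (a ∷ (a xor b) ∷ []))))
    (cong weightT (∂²-replicate-++ a b m)))
  where x = replicate (2 + m) false ++ (a ∷ b ∷ [])

periodic-unfold₁ : ∀ b k → periodic b [] (suc k) ≡ b ∷ periodic b [] k
periodic-unfold₁ b zero    = refl
periodic-unfold₁ b (suc k) = refl

periodic-unfold₂ : ∀ b c k → periodic b (c ∷ []) (2 + k) ≡ b ∷ c ∷ periodic b (c ∷ []) k
periodic-unfold₂ b c zero    = refl
periodic-unfold₂ b c (suc k) = refl

periodic-[]≡replicate : ∀ b k → periodic b [] k ≡ replicate k b
periodic-[]≡replicate b zero    = refl
periodic-[]≡replicate b (suc k) =
  trans (periodic-unfold₁ b k) (cong (b ∷_) (periodic-[]≡replicate b k))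

periodic-not≡alternating : ∀ b k → periodic b (not b ∷ []) k ≡ alternating b k
periodic-not≡alternating b zero          = refl
periodic-not≡alternating b (suc zero)    = refl
periodic-not≡alternating b (suc (suc k)) = begin
  periodic b (not b ∷ []) (2 + k)       ≡⟨ periodic-unfold₂ b (not b) k ⟩
  b ∷ not b ∷ periodic b (not b ∷ []) k
    ≡⟨ cong (λ w → b ∷ not b ∷ w) (periodic-not≡alternating b k) ⟩
  b ∷ not b ∷ alternating b k           ≡⟨ sym (alternating-2+ b k) ⟩
  alternating b (2 + k)                 ∎

weightT-2+-cong : (x : ℕ → List Bool) {y : ℕ → List Bool} (d : ℕ) → (∀ m → x m ≡ y m) →
  (∀ m → weightT (y (2 + m)) ≡ d + weightT (y m)) → ∀ m → weightT (x (2 + m)) ≡ d + weightT (x m)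
weightT-2+-cong x {y} d x≡y step m = begin
  weightT (x (2 + m)) ≡⟨ cong weightT (x≡y (2 + m)) ⟩
  weightT (y (2 + m)) ≡⟨ step m ⟩
  d + weightT (y m)   ≡⟨ cong (λ w → d + weightT w) (sym (x≡y m)) ⟩
  d + weightT (x m)   ∎

weightT-periodic-not-2+ : ∀ b m →
  weightT (periodic b (not b ∷ []) (2 + (2 + m))) ≡ 3 + weightT (periodic b (not b ∷ []) (2 + m))
weightT-periodic-not-2+ b =
  weightT-2+-cong (λ m → periodic b (not b ∷ []) (2 + m)) 3
    (λ m → periodic-not≡alternating b (2 + m)) (weightT-alternating-2+ b)

weightT-++-periodic-2+ : ∀ a b m →
  weightT ((a ∷ b ∷ []) ++ periodic false [] (2 + m))
    ≡ weight (a ∷ b ∷ []) + weight ((a xor b) ∷ b ∷ []) + weightT ((a ∷ b ∷ []) ++ periodic false [] m)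
weightT-++-periodic-2+ a b =
  weightT-2+-cong (λ m → (a ∷ b ∷ []) ++ periodic false [] m)
    (weight (a ∷ b ∷ []) + weight ((a xor b) ∷ b ∷ []))
    (λ m → cong ((a ∷ b ∷ []) ++_) (periodic-[]≡replicate false m))
    (weightT-++-replicate-2+ a b)

weightT-periodic-++-2+ : ∀ a b m →
  weightT (periodic false [] (2 + m) ++ (a ∷ b ∷ []))
    ≡ weight (a ∷ b ∷ []) + weight (a ∷ (a xor b) ∷ []) + weightT (periodic false [] m ++ (a ∷ b ∷ []))
weightT-periodic-++-2+ a b =
  weightT-2+-cong (λ m → periodic false [] m ++ (a ∷ b ∷ []))
    (weight (a ∷ b ∷ []) + weight (a ∷ (a xor b) ∷ []))
    (λ m → cong (_++ (a ∷ b ∷ [])) (periodic-[]≡replicate false m))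
    (weightT-replicate-++-2+ a b)

-- The index m stands for the length n = 2 + m of the word.
invariant-mod-2 : {f : ℕ → ℕ} → (∀ m → f (2 + m) ≡ 3 + f m) →
  ∀ {c r} → 2 * f r + c ≡ 3 * (2 + r) → ∀ j → 2 * f (j * 2 + r) + c ≡ 3 * (2 + (j * 2 + r))
invariant-mod-2 step base zero = base
invariant-mod-2 {f} step {c} {r} base (suc j) = begin
  2 * f (2 + m) + c     ≡⟨ cong (λ v → 2 * v + c) (step m) ⟩
  2 * (3 + f m) + c     ≡⟨ cong (_+ c) (*-distribˡ-+ 2 3 (f m)) ⟩
  6 + 2 * f m + c       ≡⟨ +-assoc 6 (2 * f m) c ⟩
  6 + (2 * f m + c)     ≡⟨ cong (6 +_) (invariant-mod-2 step base j) ⟩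
  6 + 3 * (2 + m)       ≡⟨ sym (*-distribˡ-+ 3 2 (2 + m)) ⟩
  3 * (2 + (2 + m))     ∎
  where m = j * 2 + r

m+n≡o⇒m≡o∸n : ∀ {m n o} → m + n ≡ o → m ≡ o ∸ n
m+n≡o⇒m≡o∸n {m} {n} refl = sym (m+n∸n≡m m n)

closed-form-mod-2 : {f : ℕ → ℕ} → (∀ m → f (2 + m) ≡ 3 + f m) →
  ∀ {c r} → 2 * f r + c ≡ 3 * (2 + r) → ∀ j → 2 * f (j * 2 + r) ≡ 3 * (2 + (j * 2 + r)) ∸ c
closed-form-mod-2 step base j = m+n≡o⇒m≡o∸n (invariant-mod-2 step base j)

data EvenOdd : ℕ → Set where
  even : ∀ j → EvenOdd (j * 2 + 0)
  odd  : ∀ j → EvenOdd (j * 2 + 1)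

evenOdd : ∀ m → EvenOdd m
evenOdd zero          = even 0
evenOdd (suc zero)    = odd 0
evenOdd (suc (suc m)) with evenOdd m
... | even j = even (suc j)
... | odd j  = odd (suc j)

proposition5p4 : (n : ℕ) → 4 ≤ n →
    let b₁ = periodic true (false ∷ []) n
        b₂ = (false ∷ true ∷ []) ++ periodic false [] (n ∸ 2)
        b₃ = periodic false [] (n ∸ 2) ++ (true ∷ true ∷ [])
        b₄ = periodic false (true ∷ []) n
        b₅ = (true ∷ true ∷ []) ++ periodic false [] (n ∸ 2)
        b₆ = periodic false [] (n ∸ 2) ++ (true ∷ false ∷ [])
    in (2 ∣ n →
          (2 * weightT b₁ ≡ 3 * n ∸ 2) × (2 * weightT b₂ ≡ 3 * n ∸ 2)
          × (2 * weightT b₃ ≡ 3 * n ∸ 2) × (2 * weightT b₄ ≡ 3 * n ∸ 2)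
          × (2 * weightT b₅ ≡ 3 * n ∸ 2) × (2 * weightT b₆ ≡ 3 * n ∸ 2))
       × (¬ (2 ∣ n) →
          (2 * weightT b₁ ≡ 3 * n ∸ 1) × (2 * weightT b₃ ≡ 3 * n ∸ 1)
          × (2 * weightT b₅ ≡ 3 * n ∸ 1)
          × (2 * weightT b₂ ≡ 3 * n ∸ 3) × (2 * weightT b₄ ≡ 3 * n ∸ 3)
          × (2 * weightT b₆ ≡ 3 * n ∸ 3))
proposition5p4 (suc (suc m)) (s≤s (s≤s _)) with evenOdd m
... | even j =
  (λ _ → closed-form-mod-2 (weightT-periodic-not-2+ true) refl j
       , closed-form-mod-2 (weightT-++-periodic-2+ false true) refl j
       , closed-form-mod-2 (weightT-periodic-++-2+ true true) refl j
       , closed-form-mod-2 (weightT-periodic-not-2+ false) refl j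
       , closed-form-mod-2 (weightT-++-periodic-2+ true true) refl j
       , closed-form-mod-2 (weightT-periodic-++-2+ true false) refl j)
  , contradiction (∣m∣n⇒∣m+n (n∣m*n (suc j)) (2 ∣0))
... | odd j =
  (λ 2∣n → contradiction (∣1⇒≡1 (∣m+n∣m⇒∣n 2∣n (n∣m*n (suc j)))) λ ())
  , (λ _ → closed-form-mod-2 (weightT-periodic-not-2+ true) refl j
         , closed-form-mod-2 (weightT-periodic-++-2+ true true) refl j
         , closed-form-mod-2 (weightT-++-periodic-2+ true true) refl j
         , closed-form-mod-2 (weightT-++-periodic-2+ false true) refl j
         , closed-form-mod-2 (weightT-periodic-not-2+ false) refl j
         , closed-form-mod-2 (weightT-periodic-++-2+ true false) refl j)
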